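{- Let $f,g:\{0,1\}^n\to\{0,1\}$ and write $\mathbb{E}[f]=p_1$, $\mathbb{E}[g]=p_2$ (expectations with respect to the uniform measure). Then \[ \sum_{S\subseteq\{1,\dots,n\}}\left(\tfrac13\right)^{|S|}\hat f(S)\hat g(S)\le \min\left(p_1^{0.9}p_2^{0.5},\ p_1^{0.75}p_2^{0.75}\right). \]
   Context: On $\{0,1\}^n$ with the uniform measure, for $S\subseteq\{1,\dots,n\}$ let $r_S(x)=\prod_{i\in S}(2x_i-1)$, and for a real function $f$ let $\hat f(S)=\mathbb{E}[f\,r_S]$ be its Fourier–Walsh coefficients. -}

module Defs where

open import Data.Bool using (Bool; true; false)
open import Data.Nat using (ℕ; zero; suc)
open import Data.Vec using (Vec; []; _∷_)
open import Data.List using (List; []; _∷_; map; _++_)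
open import Data.Rational using (ℚ; 0ℚ; 1ℚ; ½; _+_; _*_; -_; _/_)
open import Data.Integer using (+_)

-- The cube {0,1}^n: points are bit vectors (true = 1, false = 0).
-- Subsets S ⊆ {1,…,n} are also represented by their indicator vectors.
Cube : ℕ → Set
Cube n = Vec Bool n

allPoints : (n : ℕ) → List (Cube n)
allPoints zero = [] ∷ []
allPoints (suc n) = map (false ∷_) (allPoints n) ++ map (true ∷_) (allPoints n)

sumL : {A : Set} → (A → ℚ) → List A → ℚ
sumL f [] = 0ℚ
sumL f (x ∷ xs) = f x + sumL f xs

_^ℚ_ : ℚ → ℕ → ℚ
q ^ℚ zero = 1ℚ
q ^ℚ suc k = q * (q ^ℚ k)

bit : Bool → ℚ
bit true = 1ℚ
bit false = 0ℚ

sgn : Bool → ℚ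
sgn true = 1ℚ
sgn false = - 1ℚ

𝔼 : (n : ℕ) → (Cube n → ℚ) → ℚ
𝔼 n h = (½ ^ℚ n) * sumL h (allPoints n)

walsh : {n : ℕ} → Cube n → Cube n → ℚ
walsh [] [] = 1ℚ
walsh (true ∷ S) (b ∷ x) = sgn b * walsh S x
walsh (false ∷ S) (b ∷ x) = walsh S x

card : {n : ℕ} → Cube n → ℕ
card [] = zero
card (true ∷ S) = suc (card S)
card (false ∷ S) = card S

toℚ : {n : ℕ} → (Cube n → Bool) → Cube n → ℚ
toℚ f x = bit (f x)

fhat : {n : ℕ} → (Cube n → ℚ) → Cube n → ℚ
fhat {n} f S = 𝔼 n (λ x → f x * walsh S x)

⅓ : ℚ
⅓ = + 1 / 3

noiseCorr : (n : ℕ) → (Cube n → Bool) → (Cube n → Bool) → ℚ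
noiseCorr n f g =
  sumL (λ S → (⅓ ^ℚ card S) * (fhat (toℚ f) S * fhat (toℚ g) S)) (allPoints n)

-- For ρ ∈ [0, 1] let S_ρ(F) = Σ_S ρ^|S| F̂(S)². Splitting off the first coordinate,
-- S_ρ(f) = (1 + ρ)/4 (S_ρ(f₀) + S_ρ(f₁)) + (1 − ρ)/2 B_ρ(f₀, f₁) with B_ρ(f₀, f₁)² ≤ S_ρ(f₀) S_ρ(f₁),
-- so by induction on n the Bonami–Beckner two-point inequality for q = 1 + ρ tensorises to
-- S_ρ(f) ≤ E[f]^(2/q) for Boolean f. The two cases needed, ρ = 1/3 and ρ = 1/9, are univariate
-- polynomial inequalities, certified as (x − 1)⁴ times a polynomial with nonnegative coefficients.
-- Cauchy–Schwarz then gives L² ≤ S_{1/3}(f) S_{1/3}(g) ≤ (p₁ p₂)^(3/2) and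
-- L² ≤ S_{1/9}(f) E[g] ≤ p₁^(9/5) p₂.
-- Since ℚ has no roots, the induction proves "E[f] < u^K implies S_ρ(f) ≤ u^M" for rational u, and
-- the exact bound is recovered from rational approximate roots.

module Submission where

open import Defs
open import Data.Bool using (Bool; true; false)
open import Data.Empty using (⊥-elim)
import Data.Integer as ℤ
import Data.Integer.Properties as ℤ
open import Data.List using (List; []; _∷_; map; _++_)
open import Data.List.Properties using (≡-dec)
open import Data.Nat as ℕ using (ℕ; zero; suc)
import Data.Nat.Properties as ℕ
open import Data.Product using (Σ; ∃; _×_; _,_; proj₁; proj₂)
open import Data.Rational
  using (ℚ; mkℚ; 0ℚ; 1ℚ; ½; _+_; _*_; -_; _-_; _≤_; _<_; 1/_; positive; nonNegative; *≤*)
open import Data.Rational.Literals using (fromℤ)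
open import Data.Rational.Properties
import Data.Rational.Unnormalised as ℚᵘ
import Data.Rational.Unnormalised.Properties as ℚᵘ
open import Data.Sum using (inj₁; inj₂)
open import Data.Vec using ([]; _∷_)
open import Level using (0ℓ)
open import Relation.Binary.PropositionalEquality
  using (_≡_; refl; sym; trans; cong; cong₂; subst; subst₂; module ≡-Reasoning)
open import Relation.Nullary using (¬_; Dec; yes; no)
open import Relation.Nullary.Decidable using (toWitness; dec⇒maybe)
open import Tactic.RingSolver using (solve-∀)
open import Tactic.RingSolver.Core.AlmostCommutativeRing
  using (AlmostCommutativeRing; fromCommutativeRing)

ℚ-ring : AlmostCommutativeRing 0ℓ 0ℓ
ℚ-ring = fromCommutativeRing +-*-commutativeRing (λ x → dec⇒maybe (0ℚ ≟ x))

0≤1 : 0ℚ ≤ 1ℚ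
0≤1 = nonNegative⁻¹ 1ℚ

0<1 : 0ℚ < 1ℚ
0<1 = positive⁻¹ 1ℚ

+-nonNeg : ∀ {p q} → 0ℚ ≤ p → 0ℚ ≤ q → 0ℚ ≤ p + q
+-nonNeg = +-mono-≤

*-nonNeg : ∀ {p q} → 0ℚ ≤ p → 0ℚ ≤ q → 0ℚ ≤ p * q
*-nonNeg {p} {q} 0≤p 0≤q = nonNegative⁻¹ (p * q)
  {{nonNeg*nonNeg⇒nonNeg p {{nonNegative 0≤p}} q {{nonNegative 0≤q}}}}

*-pos : ∀ {p q} → 0ℚ < p → 0ℚ < q → 0ℚ < p * q
*-pos {p} {q} 0<p 0<q = positive⁻¹ (p * q) {{pos*pos⇒pos p {{positive 0<p}} q {{positive 0<q}}}}

*-monoˡ-≤ : ∀ {r p q} → 0ℚ ≤ r → p ≤ q → r * p ≤ r * q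
*-monoˡ-≤ {r} 0≤r = *-monoˡ-≤-nonNeg r {{nonNegative 0≤r}}

*-monoʳ-≤ : ∀ {r p q} → 0ℚ ≤ r → p ≤ q → p * r ≤ q * r
*-monoʳ-≤ {r} 0≤r = *-monoʳ-≤-nonNeg r {{nonNegative 0≤r}}

*-mono-≤ : ∀ {p q r s} → 0ℚ ≤ p → p ≤ q → 0ℚ ≤ r → r ≤ s → p * r ≤ q * s
*-mono-≤ 0≤p p≤q 0≤r r≤s = ≤-trans (*-monoˡ-≤ 0≤p r≤s) (*-monoʳ-≤ (≤-trans 0≤r r≤s) p≤q)

*-cancelʳ-≤ : ∀ {r p q} → 0ℚ < r → p * r ≤ q * r → p ≤ q
*-cancelʳ-≤ {r} 0<r = *-cancelʳ-≤-pos r {{positive 0<r}}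

*-cancelʳ-< : ∀ {r p q} → 0ℚ < r → p * r < q * r → p < q
*-cancelʳ-< {r} 0<r = *-cancelʳ-<-nonNeg r {{nonNegative (<⇒≤ 0<r)}}

square-nonNeg : ∀ p → 0ℚ ≤ p * p
square-nonNeg p with ≤-total 0ℚ p
... | inj₁ 0≤p = *-nonNeg 0≤p 0≤p
... | inj₂ p≤0 = subst (0ℚ ≤_) (neg*neg p) (*-nonNeg (neg-antimono-≤ p≤0) (neg-antimono-≤ p≤0))
  where
  neg*neg : ∀ p → (- p) * (- p) ≡ p * p
  neg*neg = solve-∀ ℚ-ring

<⇒≱ : ∀ {p q} → p < q → ¬ q ≤ p
<⇒≱ p<q q≤p = <-irrefl refl (<-≤-trans p<q q≤p)

p≤q⇒0≤q-p : ∀ {p q} → p ≤ q → 0ℚ ≤ q - p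
p≤q⇒0≤q-p {p} {q} p≤q = subst (_≤ q - p) (+-inverseʳ p) (+-monoˡ-≤ (- p) p≤q)

p<q⇒0<q-p : ∀ {p q} → p < q → 0ℚ < q - p
p<q⇒0<q-p {p} {q} p<q = subst (_< q - p) (+-inverseʳ p) (+-monoˡ-< (- p) p<q)

0≤q-p⇒p≤q : ∀ {p q} → 0ℚ ≤ q - p → p ≤ q
0≤q-p⇒p≤q {p} {q} 0≤q-p = subst₂ _≤_ (+-identityʳ p) (p+[q-p]≡q p q) (+-monoʳ-≤ p 0≤q-p)
  where
  p+[q-p]≡q : ∀ p q → p + (q - p) ≡ q
  p+[q-p]≡q = solve-∀ ℚ-ring

p≤p+q : ∀ p {q} → 0ℚ ≤ q → p ≤ p + q
p≤p+q p {q} 0≤q = subst (_≤ p + q) (+-identityʳ p) (+-monoʳ-≤ p 0≤q)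

q≤p+q : ∀ {p} q → 0ℚ ≤ p → q ≤ p + q
q≤p+q {p} q 0≤p = subst (_≤ p + q) (+-identityˡ q) (+-monoˡ-≤ q 0≤p)

p<p+q : ∀ p {q} → 0ℚ < q → p < p + q
p<p+q p {q} 0<q = subst (_< p + q) (+-identityʳ p) (+-monoʳ-< p 0<q)

^-nonNeg : ∀ {x} k → 0ℚ ≤ x → 0ℚ ≤ x ^ℚ k
^-nonNeg zero    0≤x = 0≤1
^-nonNeg (suc k) 0≤x = *-nonNeg 0≤x (^-nonNeg k 0≤x)

^-monoˡ-≤ : ∀ {x y} k → 0ℚ ≤ x → x ≤ y → x ^ℚ k ≤ y ^ℚ k
^-monoˡ-≤ zero    0≤x x≤y = ≤-refl
^-monoˡ-≤ (suc k) 0≤x x≤y = *-mono-≤ 0≤x x≤y (^-nonNeg k 0≤x) (^-monoˡ-≤ k 0≤x x≤y)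

^-monoˡ-< : ∀ {x y} k → 0ℚ ≤ x → x < y → x ^ℚ suc k < y ^ℚ suc k
^-monoˡ-< {x} {y} k 0≤x x<y = ≤-<-trans
  (*-monoˡ-≤ 0≤x (^-monoˡ-≤ k 0≤x (<⇒≤ x<y)))
  (*-monoˡ-<-pos (y ^ℚ k) {{positive (^-pos k)}} x<y)
  where
  ^-pos : ∀ k → 0ℚ < y ^ℚ k
  ^-pos zero    = 0<1
  ^-pos (suc k) = *-pos (≤-<-trans 0≤x x<y) (^-pos k)

^-cancelˡ-≤ : ∀ {x y} k → 0ℚ ≤ y → x ^ℚ suc k ≤ y ^ℚ suc k → x ≤ y
^-cancelˡ-≤ {x} {y} k 0≤y xᵏ≤yᵏ with x ≤? y
... | yes x≤y = x≤y
... | no  x≰y = ⊥-elim (<⇒≱ (^-monoˡ-< k 0≤y (≰⇒> x≰y)) xᵏ≤yᵏ)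

^-zeroˡ : ∀ k → 0ℚ ^ℚ suc k ≡ 0ℚ
^-zeroˡ k = *-zeroˡ (0ℚ ^ℚ k)

1^k≡1 : ∀ k → 1ℚ ^ℚ k ≡ 1ℚ
1^k≡1 zero    = refl
1^k≡1 (suc k) = trans (*-identityˡ _) (1^k≡1 k)

^-≤1 : ∀ {x} k → 0ℚ ≤ x → x ≤ 1ℚ → x ^ℚ k ≤ 1ℚ
^-≤1 {x} k 0≤x x≤1 = subst (x ^ℚ k ≤_) (1^k≡1 k) (^-monoˡ-≤ k 0≤x x≤1)

1≤^ : ∀ {x} k → 1ℚ ≤ x → 1ℚ ≤ x ^ℚ k
1≤^ {x} k 1≤x = subst (_≤ x ^ℚ k) (1^k≡1 k) (^-monoˡ-≤ k 0≤1 1≤x)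

≤-^ : ∀ {x} k → 1ℚ ≤ x → x ≤ x ^ℚ suc k
≤-^ {x} k 1≤x = subst (_≤ x ^ℚ suc k) (*-identityʳ x) (*-monoˡ-≤ (≤-trans 0≤1 1≤x) (1≤^ k 1≤x))

^-distribʳ-* : ∀ x y k → (x * y) ^ℚ k ≡ x ^ℚ k * y ^ℚ k
^-distribʳ-* x y zero    = refl
^-distribʳ-* x y (suc k) = trans (cong ((x * y) *_) (^-distribʳ-* x y k)) (interchange x y _ _)
  where
  interchange : ∀ x y a b → x * y * (a * b) ≡ x * a * (y * b)
  interchange = solve-∀ ℚ-ring

^-distribˡ-+-* : ∀ x a b → x ^ℚ (a ℕ.+ b) ≡ x ^ℚ a * x ^ℚ b
^-distribˡ-+-* x zero    b = sym (*-identityˡ _)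
^-distribˡ-+-* x (suc a) b = trans (cong (x *_) (^-distribˡ-+-* x a b)) (sym (*-assoc x _ _))

^-*-assoc : ∀ x a b → (x ^ℚ a) ^ℚ b ≡ x ^ℚ (a ℕ.* b)
^-*-assoc x zero    b = 1^k≡1 b
^-*-assoc x (suc a) b = begin
  (x * x ^ℚ a) ^ℚ b         ≡⟨ ^-distribʳ-* x (x ^ℚ a) b ⟩
  x ^ℚ b * (x ^ℚ a) ^ℚ b    ≡⟨ cong (x ^ℚ b *_) (^-*-assoc x a b) ⟩
  x ^ℚ b * x ^ℚ (a ℕ.* b)   ≡⟨ sym (^-distribˡ-+-* x b (a ℕ.* b)) ⟩
  x ^ℚ (b ℕ.+ a ℕ.* b)      ∎
  where open ≡-Reasoning

^-swap : ∀ x a b → (x ^ℚ a) ^ℚ b ≡ (x ^ℚ b) ^ℚ a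
^-swap x a b = trans (^-*-assoc x a b)
  (trans (cong (x ^ℚ_) (ℕ.*-comm a b)) (sym (^-*-assoc x b a)))

-- Finite sums and the Cauchy–Schwarz inequality

module _ {A : Set} where

  sumL-++ : (f : A → ℚ) (xs ys : List A) → sumL f (xs ++ ys) ≡ sumL f xs + sumL f ys
  sumL-++ f []       ys = sym (+-identityˡ _)
  sumL-++ f (x ∷ xs) ys = trans (cong (f x +_) (sumL-++ f xs ys)) (sym (+-assoc (f x) _ _))

  sumL-cong : {f g : A → ℚ} → (∀ x → f x ≡ g x) → (xs : List A) → sumL f xs ≡ sumL g xs
  sumL-cong f≗g []       = refl
  sumL-cong f≗g (x ∷ xs) = cong₂ _+_ (f≗g x) (sumL-cong f≗g xs)

  sumL-+ : (f g : A → ℚ) (xs : List A) →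
           sumL (λ x → f x + g x) xs ≡ sumL f xs + sumL g xs
  sumL-+ f g []       = refl
  sumL-+ f g (x ∷ xs) = trans (cong (f x + g x +_) (sumL-+ f g xs)) (middle-swap (f x) (g x) _ _)
    where
    middle-swap : ∀ a b c d → a + b + (c + d) ≡ a + c + (b + d)
    middle-swap = solve-∀ ℚ-ring

  sumL-*ˡ : (c : ℚ) (f : A → ℚ) (xs : List A) → sumL (λ x → c * f x) xs ≡ c * sumL f xs
  sumL-*ˡ c f []       = sym (*-zeroʳ c)
  sumL-*ˡ c f (x ∷ xs) = trans (cong (c * f x +_) (sumL-*ˡ c f xs)) (sym (*-distribˡ-+ c (f x) _))

  sumL-nonNeg : {f : A → ℚ} → (∀ x → 0ℚ ≤ f x) → (xs : List A) → 0ℚ ≤ sumL f xs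
  sumL-nonNeg 0≤f []       = ≤-refl
  sumL-nonNeg 0≤f (x ∷ xs) = +-nonNeg (0≤f x) (sumL-nonNeg 0≤f xs)

  sumL-map : {B : Set} (f : B → ℚ) (g : A → B) (xs : List A) →
             sumL f (map g xs) ≡ sumL (λ x → f (g x)) xs
  sumL-map f g []       = refl
  sumL-map f g (x ∷ xs) = cong (f (g x) +_) (sumL-map f g xs)

-- Completing the square: (A b² + D a²)² − (2abC)² = (A b² − D a²)² + 4a²b²(AD − C²).
cross-term-≤ : ∀ {A C D} a b → 0ℚ ≤ A → 0ℚ ≤ D → C * C ≤ A * D →
               (a * b) * C + (a * b) * C ≤ A * (b * b) + D * (a * a)
cross-term-≤ {A} {C} {D} a b 0≤A 0≤D C²≤AD =
  ^-cancelˡ-≤ 1 (+-nonNeg (*-nonNeg 0≤A (square-nonNeg b)) (*-nonNeg 0≤D (square-nonNeg a)))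
    (0≤q-p⇒p≤q (subst (0ℚ ≤_) (sym (difference-of-squares A C D a b))
      (+-nonNeg (square-nonNeg (A * (b * b) - D * (a * a)))
                (*-nonNeg (square-nonNeg (a * b + a * b)) (p≤q⇒0≤q-p C²≤AD)))))
  where
  difference-of-squares : ∀ A C D a b →
    (A * (b * b) + D * (a * a)) * ((A * (b * b) + D * (a * a)) * 1ℚ)
      - ((a * b) * C + (a * b) * C) * (((a * b) * C + (a * b) * C) * 1ℚ)
      ≡ (A * (b * b) - D * (a * a)) * (A * (b * b) - D * (a * a))
        + ((a * b + a * b) * (a * b + a * b)) * (A * D - C * C)
  difference-of-squares = solve-∀ ℚ-ring

cauchy-schwarz-step : ∀ {A C D} w a b → 0ℚ ≤ A → 0ℚ ≤ D → 0ℚ ≤ w → C * C ≤ A * D →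
  (w * (a * b) + C) * (w * (a * b) + C) ≤ (w * (a * a) + A) * (w * (b * b) + D)
cauchy-schwarz-step {A} {C} {D} w a b 0≤A 0≤D 0≤w C²≤AD =
  0≤q-p⇒p≤q (subst (0ℚ ≤_) (sym (expand A C D w a b))
    (+-nonNeg (p≤q⇒0≤q-p C²≤AD) (*-nonNeg 0≤w (p≤q⇒0≤q-p (cross-term-≤ a b 0≤A 0≤D C²≤AD)))))
  where
  expand : ∀ A C D w a b →
    (w * (a * a) + A) * (w * (b * b) + D) - (w * (a * b) + C) * (w * (a * b) + C)
      ≡ (A * D - C * C) + w * ((A * (b * b) + D * (a * a)) - ((a * b) * C + (a * b) * C))
  expand = solve-∀ ℚ-ring

cauchy-schwarz : ∀ {A : Set} (w a b : A → ℚ) → (∀ x → 0ℚ ≤ w x) → (xs : List A) →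
  let ⟨a,b⟩ = sumL (λ x → w x * (a x * b x)) xs in
  ⟨a,b⟩ * ⟨a,b⟩ ≤ sumL (λ x → w x * (a x * a x)) xs * sumL (λ x → w x * (b x * b x)) xs
cauchy-schwarz w a b 0≤w []       = ≤-refl
cauchy-schwarz w a b 0≤w (x ∷ xs) = cauchy-schwarz-step (w x) (a x) (b x)
  (sumL-nonNeg (λ y → *-nonNeg (0≤w y) (square-nonNeg (a y))) xs)
  (sumL-nonNeg (λ y → *-nonNeg (0≤w y) (square-nonNeg (b y))) xs)
  (0≤w x) (cauchy-schwarz w a b 0≤w xs)

-- Expectations and Fourier coefficients on the cube

slice₀ slice₁ : ∀ {n} {A : Set} → (Cube (suc n) → A) → Cube n → A
slice₀ F x = F (false ∷ x)
slice₁ F x = F (true ∷ x)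

sumL-allPoints-suc : ∀ {n} (h : Cube (suc n) → ℚ) →
  sumL h (allPoints (suc n)) ≡ sumL (slice₀ h) (allPoints n) + sumL (slice₁ h) (allPoints n)
sumL-allPoints-suc {n} h =
  trans (sumL-++ h (map (false ∷_) (allPoints n)) (map (true ∷_) (allPoints n)))
        (cong₂ _+_ (sumL-map h (false ∷_) (allPoints n)) (sumL-map h (true ∷_) (allPoints n)))

𝔼-zero : (F : Cube zero → ℚ) → 𝔼 zero F ≡ F []
𝔼-zero F = trans (*-identityˡ _) (+-identityʳ (F []))

𝔼-suc : ∀ {n} (F : Cube (suc n) → ℚ) → 𝔼 (suc n) F ≡ ½ * (𝔼 n (slice₀ F) + 𝔼 n (slice₁ F))
𝔼-suc {n} F = trans (cong ((½ * ½ ^ℚ n) *_) (sumL-allPoints-suc F)) (distrib ½ (½ ^ℚ n) _ _)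
  where
  distrib : ∀ h k a b → h * k * (a + b) ≡ h * (k * a + k * b)
  distrib = solve-∀ ℚ-ring

𝔼-cong : ∀ {n} {F G : Cube n → ℚ} → (∀ x → F x ≡ G x) → 𝔼 n F ≡ 𝔼 n G
𝔼-cong {n} F≗G = cong (½ ^ℚ n *_) (sumL-cong F≗G (allPoints n))

𝔼-*ˡ : ∀ {n} c (F : Cube n → ℚ) → 𝔼 n (λ x → c * F x) ≡ c * 𝔼 n F
𝔼-*ˡ {n} c F = trans (cong (½ ^ℚ n *_) (sumL-*ˡ c F (allPoints n))) (*-left-swap (½ ^ℚ n) c _)
  where
  *-left-swap : ∀ a b c → a * (b * c) ≡ b * (a * c)
  *-left-swap = solve-∀ ℚ-ring

𝔼-nonNeg : ∀ {n} {F : Cube n → ℚ} → (∀ x → 0ℚ ≤ F x) → 0ℚ ≤ 𝔼 n F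
𝔼-nonNeg {n} 0≤F = *-nonNeg (^-nonNeg n (nonNegative⁻¹ ½)) (sumL-nonNeg 0≤F (allPoints n))

fhat-false∷ : ∀ {n} (F : Cube (suc n) → ℚ) S →
  fhat F (false ∷ S) ≡ ½ * (fhat (slice₀ F) S + fhat (slice₁ F) S)
fhat-false∷ F S = 𝔼-suc (λ x → F x * walsh (false ∷ S) x)

fhat-true∷ : ∀ {n} (F : Cube (suc n) → ℚ) S →
  fhat F (true ∷ S) ≡ ½ * (fhat (slice₁ F) S - fhat (slice₀ F) S)
fhat-true∷ {n} F S = begin
  fhat F (true ∷ S)
    ≡⟨ 𝔼-suc (λ x → F x * walsh (true ∷ S) x) ⟩
  ½ * (𝔼 n (λ x → slice₀ F x * (- 1ℚ * walsh S x)) + 𝔼 n (λ x → slice₁ F x * (1ℚ * walsh S x)))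
    ≡⟨ cong₂ (λ a b → ½ * (a + b))
         (trans (𝔼-cong (λ x → sign-out (slice₀ F x) (walsh S x)))
                (𝔼-*ˡ (- 1ℚ) (λ x → slice₀ F x * walsh S x)))
         (𝔼-cong (λ x → cong (slice₁ F x *_) (*-identityˡ (walsh S x)))) ⟩
  ½ * (- 1ℚ * fhat (slice₀ F) S + fhat (slice₁ F) S)
    ≡⟨ cong (½ *_) (difference (fhat (slice₀ F) S) (fhat (slice₁ F) S)) ⟩
  ½ * (fhat (slice₁ F) S - fhat (slice₀ F) S) ∎
  where
  open ≡-Reasoning
  sign-out : ∀ a b → a * (- 1ℚ * b) ≡ - 1ℚ * (a * b)
  sign-out = solve-∀ ℚ-ring
  difference : ∀ a b → - 1ℚ * a + b ≡ b - a
  difference = solve-∀ ℚ-ring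

-- noiseCorr n f g is noiseForm ⅓ (toℚ f) (toℚ g) by definition.
noiseForm : ℚ → ∀ {n} → (Cube n → ℚ) → (Cube n → ℚ) → ℚ
noiseForm ρ {n} F G = sumL (λ S → ρ ^ℚ card S * (fhat F S * fhat G S)) (allPoints n)

sameWeight crossWeight : ℚ → ℚ
sameWeight  ρ = ½ * ½ * (1ℚ + ρ)
crossWeight ρ = ½ * ½ * (1ℚ - ρ)

noiseForm-zero : ∀ ρ (F G : Cube zero → ℚ) → noiseForm ρ F G ≡ F [] * G []
noiseForm-zero ρ F G = simplify (F []) (G [])
  where
  simplify : ∀ a b → 1ℚ * ((1ℚ * (a * 1ℚ + 0ℚ)) * (1ℚ * (b * 1ℚ + 0ℚ))) + 0ℚ ≡ a * b
  simplify = solve-∀ ℚ-ring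

noiseForm-suc : ∀ ρ {n} (F G : Cube (suc n) → ℚ) →
  noiseForm ρ F G
    ≡ sameWeight ρ * (noiseForm ρ (slice₀ F) (slice₀ G) + noiseForm ρ (slice₁ F) (slice₁ G))
      + crossWeight ρ * (noiseForm ρ (slice₀ F) (slice₁ G) + noiseForm ρ (slice₁ F) (slice₀ G))
noiseForm-suc ρ {n} F G = begin
  noiseForm ρ F G
    ≡⟨ sumL-allPoints-suc (λ S → ρ ^ℚ card S * (fhat F S * fhat G S)) ⟩
  sumL (λ S → term F G (false ∷ S)) ps + sumL (λ S → term F G (true ∷ S)) ps
    ≡⟨ sym (sumL-+ _ _ ps) ⟩
  sumL (λ S → term F G (false ∷ S) + term F G (true ∷ S)) ps
    ≡⟨ sumL-cong split ps ⟩
  sumL (λ S → sameWeight ρ * (term F₀ G₀ S + term F₁ G₁ S)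
              + crossWeight ρ * (term F₀ G₁ S + term F₁ G₀ S)) ps
    ≡⟨ sumL-+ _ _ ps ⟩
  sumL (λ S → sameWeight ρ * (term F₀ G₀ S + term F₁ G₁ S)) ps
    + sumL (λ S → crossWeight ρ * (term F₀ G₁ S + term F₁ G₀ S)) ps
    ≡⟨ cong₂ _+_ (weighted-pair (sameWeight ρ) (term F₀ G₀) (term F₁ G₁))
                 (weighted-pair (crossWeight ρ) (term F₀ G₁) (term F₁ G₀)) ⟩
  sameWeight ρ * (noiseForm ρ F₀ G₀ + noiseForm ρ F₁ G₁)
    + crossWeight ρ * (noiseForm ρ F₀ G₁ + noiseForm ρ F₁ G₀) ∎
  where
  open ≡-Reasoning
  ps = allPoints n
  F₀ = slice₀ F
  F₁ = slice₁ F
  G₀ = slice₀ G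
  G₁ = slice₁ G

  term : ∀ {m} → (Cube m → ℚ) → (Cube m → ℚ) → Cube m → ℚ
  term F G S = ρ ^ℚ card S * (fhat F S * fhat G S)

  weighted-pair : ∀ c (u v : Cube n → ℚ) →
                  sumL (λ S → c * (u S + v S)) ps ≡ c * (sumL u ps + sumL v ps)
  weighted-pair c u v = trans (sumL-*ˡ c _ ps) (cong (c *_) (sumL-+ u v ps))

  regroup : ∀ h ρ k f₀ f₁ g₀ g₁ →
    k * ((h * (f₀ + f₁)) * (h * (g₀ + g₁))) + (ρ * k) * ((h * (f₁ - f₀)) * (h * (g₁ - g₀)))
      ≡ h * h * (1ℚ + ρ) * (k * (f₀ * g₀) + k * (f₁ * g₁))
        + h * h * (1ℚ - ρ) * (k * (f₀ * g₁) + k * (f₁ * g₀))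
  regroup = solve-∀ ℚ-ring

  split : ∀ S → term F G (false ∷ S) + term F G (true ∷ S)
              ≡ sameWeight ρ * (term F₀ G₀ S + term F₁ G₁ S)
                + crossWeight ρ * (term F₀ G₁ S + term F₁ G₀ S)
  split S = trans
    (cong₂ (λ a b → ρ ^ℚ card S * a + (ρ * ρ ^ℚ card S) * b)
      (cong₂ _*_ (fhat-false∷ F S) (fhat-false∷ G S))
      (cong₂ _*_ (fhat-true∷ F S) (fhat-true∷ G S)))
    (regroup ½ ρ (ρ ^ℚ card S) (fhat F₀ S) (fhat F₁ S) (fhat G₀ S) (fhat G₁ S))

noiseForm-comm : ∀ ρ {n} (F G : Cube n → ℚ) → noiseForm ρ F G ≡ noiseForm ρ G F
noiseForm-comm ρ {n} F G =
  sumL-cong (λ S → cong (ρ ^ℚ card S *_) (*-comm (fhat F S) (fhat G S))) (allPoints n)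

noiseForm-self-nonNeg : ∀ {ρ} {n} (F : Cube n → ℚ) → 0ℚ ≤ ρ → 0ℚ ≤ noiseForm ρ F F
noiseForm-self-nonNeg {n = n} F 0≤ρ =
  sumL-nonNeg (λ S → *-nonNeg (^-nonNeg (card S) 0≤ρ) (square-nonNeg (fhat F S))) (allPoints n)

square : ∀ x → x ^ℚ 2 ≡ x * x
square x = cong (x *_) (*-identityʳ x)

^2-nonNeg : ∀ x → 0ℚ ≤ x ^ℚ 2
^2-nonNeg x = subst (0ℚ ≤_) (sym (square x)) (square-nonNeg x)

noiseForm-cauchy-schwarz : ∀ {ρ n} (F G : Cube n → ℚ) → 0ℚ ≤ ρ →
  noiseForm ρ F G ^ℚ 2 ≤ noiseForm ρ F F * noiseForm ρ G G
noiseForm-cauchy-schwarz {ρ} {n} F G 0≤ρ =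
  subst (_≤ noiseForm ρ F F * noiseForm ρ G G) (sym (square (noiseForm ρ F G)))
    (cauchy-schwarz (λ S → ρ ^ℚ card S) (fhat F) (fhat G) (λ S → ^-nonNeg (card S) 0≤ρ) (allPoints n))

noiseForm-cauchy-schwarz′ : ∀ ρ {n} (F G : Cube n → ℚ) →
  noiseForm ρ F G ^ℚ 2 ≤ noiseForm (ρ * ρ) F F * noiseForm 1ℚ G G
noiseForm-cauchy-schwarz′ ρ {n} F G =
  subst₂ (λ l r → l ≤ r * noiseForm 1ℚ G G)
    (trans (cong (λ x → x * x) (sumL-cong (λ S → sym (mixed (card S) (fhat F S) (fhat G S))) ps))
           (sym (square (noiseForm ρ F G))))
    (sumL-cong (λ S → sym (pure (card S) (fhat F S))) ps)
    (subst (λ r → l * l ≤ A * r) (sumL-cong (λ S → cong (_* (fhat G S * fhat G S)) (sym (1^k≡1 (card S)))) ps)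
      (cauchy-schwarz (λ _ → 1ℚ) (λ S → ρ ^ℚ card S * fhat F S) (fhat G) (λ _ → 0≤1) ps))
  where
  ps = allPoints n
  l = sumL (λ S → 1ℚ * ((ρ ^ℚ card S * fhat F S) * fhat G S)) ps
  A = sumL (λ S → 1ℚ * ((ρ ^ℚ card S * fhat F S) * (ρ ^ℚ card S * fhat F S))) ps
  mixed : ∀ k a b → ρ ^ℚ k * (a * b) ≡ 1ℚ * ((ρ ^ℚ k * a) * b)
  mixed k a b = rearrange (ρ ^ℚ k) a b
    where
    rearrange : ∀ r a b → r * (a * b) ≡ 1ℚ * ((r * a) * b)
    rearrange = solve-∀ ℚ-ring
  pure : ∀ k a → (ρ * ρ) ^ℚ k * (a * a) ≡ 1ℚ * ((ρ ^ℚ k * a) * (ρ ^ℚ k * a))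
  pure k a = trans (cong (_* (a * a)) (^-distribʳ-* ρ ρ k)) (rearrange (ρ ^ℚ k) a)
    where
    rearrange : ∀ r a → r * r * (a * a) ≡ 1ℚ * ((r * a) * (r * a))
    rearrange = solve-∀ ℚ-ring

parseval : ∀ {n} (F G : Cube n → ℚ) → noiseForm 1ℚ F G ≡ 𝔼 n (λ x → F x * G x)
parseval {zero}  F G = trans (noiseForm-zero 1ℚ F G) (sym (𝔼-zero (λ x → F x * G x)))
parseval {suc n} F G = begin
  noiseForm 1ℚ F G
    ≡⟨ noiseForm-suc 1ℚ F G ⟩
  sameWeight 1ℚ * (noiseForm 1ℚ F₀ G₀ + noiseForm 1ℚ F₁ G₁)
    + crossWeight 1ℚ * cross
    ≡⟨ cong₂ (λ a b → sameWeight 1ℚ * (a + b) + crossWeight 1ℚ * cross)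
             (parseval F₀ G₀) (parseval F₁ G₁) ⟩
  sameWeight 1ℚ * (𝔼 n (λ x → F₀ x * G₀ x) + 𝔼 n (λ x → F₁ x * G₁ x))
    + crossWeight 1ℚ * cross
    ≡⟨ cross-vanishes (𝔼 n (λ x → F₀ x * G₀ x) + 𝔼 n (λ x → F₁ x * G₁ x)) cross ⟩
  ½ * (𝔼 n (λ x → F₀ x * G₀ x) + 𝔼 n (λ x → F₁ x * G₁ x))
    ≡⟨ sym (𝔼-suc (λ x → F x * G x)) ⟩
  𝔼 (suc n) (λ x → F x * G x) ∎
  where
  open ≡-Reasoning
  F₀ = slice₀ F
  F₁ = slice₁ F
  G₀ = slice₀ G
  G₁ = slice₁ G
  cross = noiseForm 1ℚ F₀ G₁ + noiseForm 1ℚ F₁ G₀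
  cross-vanishes : ∀ a c → sameWeight 1ℚ * a + crossWeight 1ℚ * c ≡ ½ * a
  cross-vanishes a c = trans (cong (½ * a +_) (*-zeroˡ c)) (+-identityʳ (½ * a))

-- Polynomials with natural coefficients

ι : ℕ → ℚ
ι n = fromℤ (ℤ.+ n)

ι-+ : ∀ m n → ι (m ℕ.+ n) ≡ ι m + ι n
ι-+ m n = toℚᵘ-injective (ℚᵘ.≃-trans (ℚᵘ.*≡* numerators) (ℚᵘ.≃-sym (toℚᵘ-homo-+ (ι m) (ι n))))
  where
  numerators : ℤ.+ (m ℕ.+ n) ℤ.* ℤ.+ 1 ≡ (ℤ.+ m ℤ.* ℤ.+ 1 ℤ.+ ℤ.+ n ℤ.* ℤ.+ 1) ℤ.* ℤ.+ 1
  numerators = cong (ℤ._* ℤ.+ 1) (trans (ℤ.pos-+ m n)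
    (sym (cong₂ ℤ._+_ (ℤ.*-identityʳ (ℤ.+ m)) (ℤ.*-identityʳ (ℤ.+ n)))))

ι-* : ∀ m n → ι (m ℕ.* n) ≡ ι m * ι n
ι-* m n = toℚᵘ-injective (ℚᵘ.≃-trans (ℚᵘ.*≡* numerators) (ℚᵘ.≃-sym (toℚᵘ-homo-* (ι m) (ι n))))
  where
  numerators : ℤ.+ (m ℕ.* n) ℤ.* ℤ.+ 1 ≡ (ℤ.+ m ℤ.* ℤ.+ n) ℤ.* ℤ.+ 1
  numerators = cong (ℤ._* ℤ.+ 1) (ℤ.pos-* m n)

ι-nonNeg : ∀ n → 0ℚ ≤ ι n
ι-nonNeg n = nonNegative⁻¹ (ι n)

Poly : Set
Poly = List ℕ

infixl 6 _+ᴾ_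
infixl 7 _*ᴾ_ _·ᴾ_

_+ᴾ_ : Poly → Poly → Poly
[]      +ᴾ q       = q
(a ∷ p) +ᴾ []      = a ∷ p
(a ∷ p) +ᴾ (b ∷ q) = (a ℕ.+ b) ∷ (p +ᴾ q)

_·ᴾ_ : ℕ → Poly → Poly
c ·ᴾ p = map (c ℕ.*_) p

_*ᴾ_ : Poly → Poly → Poly
[]      *ᴾ q = []
(c ∷ p) *ᴾ q = c ·ᴾ q +ᴾ (0 ∷ p *ᴾ q)

_^ᴾ_ : Poly → ℕ → Poly
p ^ᴾ zero  = 1 ∷ []
p ^ᴾ suc k = p *ᴾ p ^ᴾ k

X^ᴾ : ℕ → Poly
X^ᴾ zero    = 1 ∷ []
X^ᴾ (suc k) = 0 ∷ X^ᴾ k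

eval : Poly → ℚ → ℚ
eval []      x = 0ℚ
eval (c ∷ p) x = ι c + x * eval p x

eval-+ᴾ : ∀ p q x → eval (p +ᴾ q) x ≡ eval p x + eval q x
eval-+ᴾ []      q       x = sym (+-identityˡ (eval q x))
eval-+ᴾ (a ∷ p) []      x = sym (+-identityʳ (eval (a ∷ p) x))
eval-+ᴾ (a ∷ p) (b ∷ q) x =
  trans (cong₂ (λ u v → u + x * v) (ι-+ a b) (eval-+ᴾ p q x)) (regroup (ι a) (ι b) x _ _)
  where
  regroup : ∀ a b x u v → a + b + x * (u + v) ≡ a + x * u + (b + x * v)
  regroup = solve-∀ ℚ-ring

eval-·ᴾ : ∀ c p x → eval (c ·ᴾ p) x ≡ ι c * eval p x
eval-·ᴾ c []      x = sym (*-zeroʳ (ι c))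
eval-·ᴾ c (a ∷ p) x =
  trans (cong₂ (λ u v → u + x * v) (ι-* c a) (eval-·ᴾ c p x)) (factor (ι c) (ι a) x _)
  where
  factor : ∀ c a x u → c * a + x * (c * u) ≡ c * (a + x * u)
  factor = solve-∀ ℚ-ring

eval-*ᴾ : ∀ p q x → eval (p *ᴾ q) x ≡ eval p x * eval q x
eval-*ᴾ []      q x = sym (*-zeroˡ (eval q x))
eval-*ᴾ (c ∷ p) q x = begin
  eval (c ·ᴾ q +ᴾ (0 ∷ p *ᴾ q)) x              ≡⟨ eval-+ᴾ (c ·ᴾ q) (0 ∷ p *ᴾ q) x ⟩
  eval (c ·ᴾ q) x + (0ℚ + x * eval (p *ᴾ q) x) ≡⟨ cong₂ (λ u v → u + (0ℚ + x * v))
                                                         (eval-·ᴾ c q x) (eval-*ᴾ p q x) ⟩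
  ι c * eval q x + (0ℚ + x * (eval p x * eval q x)) ≡⟨ factor (ι c) x (eval p x) (eval q x) ⟩
  (ι c + x * eval p x) * eval q x                   ∎
  where
  open ≡-Reasoning
  factor : ∀ c x u v → c * v + (0ℚ + x * (u * v)) ≡ (c + x * u) * v
  factor = solve-∀ ℚ-ring

eval-^ᴾ : ∀ p k x → eval (p ^ᴾ k) x ≡ eval p x ^ℚ k
eval-^ᴾ p zero    x = trans (cong (1ℚ +_) (*-zeroʳ x)) (+-identityʳ 1ℚ)
eval-^ᴾ p (suc k) x = trans (eval-*ᴾ p (p ^ᴾ k) x) (cong (eval p x *_) (eval-^ᴾ p k x))

eval-X^ᴾ : ∀ k x → eval (X^ᴾ k) x ≡ x ^ℚ k
eval-X^ᴾ zero    x = trans (cong (1ℚ +_) (*-zeroʳ x)) (+-identityʳ 1ℚ)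
eval-X^ᴾ (suc k) x = trans (+-identityˡ _) (cong (x *_) (eval-X^ᴾ k x))

eval-monomial : ∀ c k x → eval (c ·ᴾ X^ᴾ k) x ≡ ι c * x ^ℚ k
eval-monomial c k x = trans (eval-·ᴾ c (X^ᴾ k) x) (cong (ι c *_) (eval-X^ᴾ k x))

eval-binomial : ∀ a b i j x →
  eval (a ·ᴾ X^ᴾ i +ᴾ b ·ᴾ X^ᴾ j) x ≡ ι a * x ^ℚ i + ι b * x ^ℚ j
eval-binomial a b i j x =
  trans (eval-+ᴾ (a ·ᴾ X^ᴾ i) (b ·ᴾ X^ᴾ j) x)
        (cong₂ _+_ (eval-monomial a i x) (eval-monomial b j x))

eval-trinomial : ∀ a b c i j k x →
  eval (a ·ᴾ X^ᴾ i +ᴾ b ·ᴾ X^ᴾ j +ᴾ c ·ᴾ X^ᴾ k) x ≡ ι a * x ^ℚ i + ι b * x ^ℚ j + ι c * x ^ℚ k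
eval-trinomial a b c i j k x =
  trans (eval-+ᴾ (a ·ᴾ X^ᴾ i +ᴾ b ·ᴾ X^ᴾ j) (c ·ᴾ X^ᴾ k) x)
        (cong₂ _+_ (eval-binomial a b i j x) (eval-monomial c k x))

eval-nonNeg : ∀ p {x} → 0ℚ ≤ x → 0ℚ ≤ eval p x
eval-nonNeg []      0≤x = ≤-refl
eval-nonNeg (c ∷ p) 0≤x = +-nonNeg (ι-nonNeg c) (*-nonNeg 0≤x (eval-nonNeg p 0≤x))

[x-1]⁴⁺ [x-1]⁴⁻ : Poly
[x-1]⁴⁺ = 1 ∷ 0 ∷ 6 ∷ 0 ∷ 1 ∷ []
[x-1]⁴⁻ = 0 ∷ 4 ∷ 0 ∷ 4 ∷ []

-- The hypothesis says A·Q − B·P = (x − 1)⁴ T, written with both sides moved so that it is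
-- an identity of natural-coefficient polynomials, decidable by evaluation.
quartic-certificate : ∀ A B (P Q T : Poly) →
  A ·ᴾ Q +ᴾ [x-1]⁴⁻ *ᴾ T ≡ B ·ᴾ P +ᴾ [x-1]⁴⁺ *ᴾ T →
  ∀ x → 0ℚ ≤ x → ι B * eval P x ≤ ι A * eval Q x
quartic-certificate A B P Q T identity x 0≤x =
  0≤q-p⇒p≤q (subst (0ℚ ≤_) (sym gap) (*-nonNeg (square-nonNeg (s * s)) (eval-nonNeg T 0≤x)))
  where
  s = x - 1ℚ
  a = ι A * eval Q x
  b = ι B * eval P x
  t = eval T x

  eval-sum : ∀ C R U → eval (C ·ᴾ R +ᴾ U *ᴾ T) x ≡ ι C * eval R x + eval U x * t
  eval-sum C R U = trans (eval-+ᴾ (C ·ᴾ R) (U *ᴾ T) x) (cong₂ _+_ (eval-·ᴾ C R x) (eval-*ᴾ U T x))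

  evaluated : a + eval [x-1]⁴⁻ x * t ≡ b + eval [x-1]⁴⁺ x * t
  evaluated = trans (sym (eval-sum A Q [x-1]⁴⁻)) (trans (cong (λ p → eval p x) identity)
                                                         (eval-sum B P [x-1]⁴⁺))

  difference : ∀ a b n p t → a - b ≡ (a + n * t) - (b + p * t) + (p - n) * t
  difference = solve-∀ ℚ-ring

  cancel : ∀ c u → c - c + u ≡ u
  cancel = solve-∀ ℚ-ring

  fourth-power : ∀ x → ι 1 + x * (ι 0 + x * (ι 6 + x * (ι 0 + x * (ι 1 + x * 0ℚ))))
                       - (ι 0 + x * (ι 4 + x * (ι 0 + x * (ι 4 + x * 0ℚ))))
                       ≡ ((x - 1ℚ) * (x - 1ℚ)) * ((x - 1ℚ) * (x - 1ℚ))
  fourth-power = solve-∀ ℚ-ring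

  gap : a - b ≡ (s * s) * (s * s) * t
  gap = begin
    a - b
      ≡⟨ difference a b (eval [x-1]⁴⁻ x) (eval [x-1]⁴⁺ x) t ⟩
    (a + eval [x-1]⁴⁻ x * t) - (b + eval [x-1]⁴⁺ x * t) + (eval [x-1]⁴⁺ x - eval [x-1]⁴⁻ x) * t
      ≡⟨ cong₂ (λ l u → l - (b + eval [x-1]⁴⁺ x * t) + u * t) evaluated (fourth-power x) ⟩
    (b + eval [x-1]⁴⁺ x * t) - (b + eval [x-1]⁴⁺ x * t) + (s * s) * (s * s) * t
      ≡⟨ cancel (b + eval [x-1]⁴⁺ x * t) _ ⟩
    (s * s) * (s * s) * t ∎
    where open ≡-Reasoning

certified-^-≤ : ∀ A B (P Q T : Poly) K M a b r → 0ℚ ≤ r → r * ι B ≡ a ^ℚ K → r * ι A ≡ b ^ℚ M →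
  A ·ᴾ Q ^ᴾ M +ᴾ [x-1]⁴⁻ *ᴾ T ≡ B ·ᴾ P ^ᴾ K +ᴾ [x-1]⁴⁺ *ᴾ T →
  ∀ x → 0ℚ ≤ x → (a * eval P x) ^ℚ K ≤ (b * eval Q x) ^ℚ M
certified-^-≤ A B P Q T K M a b r 0≤r rB≡aᴷ rA≡bᴹ identity x 0≤x =
  subst₂ _≤_ (scaled B a (eval P x) K rB≡aᴷ) (scaled A b (eval Q x) M rA≡bᴹ)
    (*-monoˡ-≤ 0≤r (subst₂ (λ u v → ι B * u ≤ ι A * v) (eval-^ᴾ P K x) (eval-^ᴾ Q M x)
                            (quartic-certificate A B (P ^ᴾ K) (Q ^ᴾ M) T identity x 0≤x)))
  where
  scaled : ∀ C c y k → r * ι C ≡ c ^ℚ k → r * (ι C * y ^ℚ k) ≡ (c * y) ^ℚ k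
  scaled C c y k rC≡cᵏ = trans (sym (*-assoc r (ι C) _))
    (trans (cong (_* y ^ℚ k) rC≡cᵏ) (sym (^-distribʳ-* c y k)))

-- The Bonami–Beckner two-point inequality ‖T_√ρ h‖₂ ≤ ‖h‖_q with q = K/m, for h = (x^m, 1),
-- raised to the power 2K.
TwoPoint : ℚ → ℕ → ℕ → Set
TwoPoint ρ K m = ∀ x → 0ℚ ≤ x →
  (sameWeight ρ * (x ^ℚ (m ℕ.+ m) + 1ℚ) + crossWeight ρ * (x ^ℚ m + x ^ℚ m)) ^ℚ K
    ≤ (½ * (x ^ℚ K + 1ℚ)) ^ℚ (m ℕ.+ m)

-- 81 (1 + x⁴)⁶ − 64 (1 + x³ + x⁶)⁴ = (x − 1)⁴ T(x).
twoPoint-⅓ : TwoPoint ⅓ 4 3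
twoPoint-⅓ x 0≤x = subst₂ (λ l r → l ^ℚ 4 ≤ r ^ℚ 6) (sym lhs) (sym rhs)
  (certified-^-≤ 81 64 P Q T 4 6 ⅓ ½ (⅓ ^ℚ 4 * ½ ^ℚ 6) (nonNegative⁻¹ _) refl refl
    (toWitness {a? = ≡-dec ℕ._≟_ _ _} _) x 0≤x)
  where
  P Q T : Poly
  P = 1 ·ᴾ X^ᴾ 0 +ᴾ 1 ·ᴾ X^ᴾ 3 +ᴾ 1 ·ᴾ X^ᴾ 6
  Q = 1 ·ᴾ X^ᴾ 0 +ᴾ 1 ·ᴾ X^ᴾ 4
  T =
    17 ∷ 68 ∷ 170 ∷ 84 ∷ 57 ∷ 336 ∷ 528 ∷ 240 ∷ 294 ∷ 488 ∷ 620 ∷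
    488 ∷ 294 ∷ 240 ∷ 528 ∷ 336 ∷ 57 ∷ 84 ∷ 170 ∷ 68 ∷ 17 ∷ []

  collect : ∀ X Y → sameWeight ⅓ * (X + 1ℚ) + crossWeight ⅓ * (Y + Y)
                    ≡ ⅓ * (ι 1 * 1ℚ + ι 1 * Y + ι 1 * X)
  collect = solve-∀ ℚ-ring
  lhs : sameWeight ⅓ * (x ^ℚ 6 + 1ℚ) + crossWeight ⅓ * (x ^ℚ 3 + x ^ℚ 3) ≡ ⅓ * eval P x
  lhs = trans (collect (x ^ℚ 6) (x ^ℚ 3)) (cong (⅓ *_) (sym (eval-trinomial 1 1 1 0 3 6 x)))

  collect′ : ∀ X → ½ * (X + 1ℚ) ≡ ½ * (ι 1 * 1ℚ + ι 1 * X)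
  collect′ = solve-∀ ℚ-ring
  rhs : ½ * (x ^ℚ 4 + 1ℚ) ≡ ½ * eval Q x
  rhs = trans (collect′ (x ^ℚ 4)) (cong (½ *_) (sym (eval-binomial 1 1 0 4 x)))

-- 18¹⁰ (1 + x¹⁰)¹⁸ − 2¹⁸ (5 + 8x⁹ + 5x¹⁸)¹⁰ = (x − 1)⁴ T(x).
twoPoint-⅑ : TwoPoint (⅓ * ⅓) 10 9
twoPoint-⅑ x 0≤x = subst₂ (λ l r → l ^ℚ 10 ≤ r ^ℚ 18) (sym lhs) (sym rhs)
  (certified-^-≤ 3570467226624 262144 P Q T 10 18 (½ * ⅓ * ⅓) ½ ((½ * ⅓ * ⅓) ^ℚ 10 * ½ ^ℚ 18)
    (nonNegative⁻¹ _) refl refl (toWitness {a? = ≡-dec ℕ._≟_ _ _} _) x 0≤x)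
  where
  P Q T : Poly
  P = 5 ·ᴾ X^ᴾ 0 +ᴾ 8 ·ᴾ X^ᴾ 9 +ᴾ 5 ·ᴾ X^ᴾ 18
  Q = 1 ·ᴾ X^ᴾ 0 +ᴾ 1 ·ᴾ X^ᴾ 10
  T =
    1010467226624 ∷ 4041868906496 ∷ 10104672266240 ∷ 20209344532480 ∷ 35366352931840 ∷
    56586164690944 ∷ 84879247036416 ∷ 121256067194880 ∷ 166727092392960 ∷ 181342789857280 ∷
    189422036893696 ∷ 215283710808064 ∷ 283246688906240 ∷ 417629848494080 ∷ 642752066877440 ∷
    982932221362176 ∷ 1462489189254144 ∷ 2105741847859200 ∷ 2616497074483200 ∷ 2698561746432000 ∷
    2602024226684928 ∷ 2576972878221312 ∷ 2873496064020480 ∷ 3741682147061760 ∷ 5431619490324480 ∷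
    8193396456787968 ∷ 12277101409431552 ∷ 16305891511234560 ∷ 18902923925176320 ∷ 18691355814236160 ∷
    17207845598318592 ∷ 15989051697328128 ∷ 16571632531169280 ∷ 20492246519746560 ∷ 29287552082964480 ∷
    44494207640727552 ∷ 61651160252940288 ∷ 76297356979507200 ∷ 83971744880332800 ∷ 80213271015321600 ∷
    71486512157847552 ∷ 64256045081284608 ∷ 64986446559006720 ∷ 80142293364387840 ∷ 116188162270801920 ∷
    162541458160422912 ∷ 208619585915424768 ∷ 243839950417981440 ∷ 257619956550266880 ∷ 239377009194455040 ∷
    209120276430434304 ∷ 186858926338093056 ∷ 192602126997319680 ∷ 246359046488002560 ∷ 329415393408430080 ∷
    423056876356890624 ∷ 508569203931672576 ∷ 567238084731064320 ∷ 580349227353354240 ∷ 529188340396830720 ∷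
    461323286054830080 ∷ 424321926520688640 ∷ 465752123987742720 ∷ 561247780785008640 ∷ 686442799241502720 ∷
    816971081686241280 ∷ 928466530448240640 ∷ 996563047856517120 ∷ 996894536240087040 ∷ 905094897927966720 ∷
    810424584269254656 ∷ 802144046613049344 ∷ 858587306297057280 ∷ 958088384658984960 ∷ 1078981303036538880 ∷
    1199600082767425536 ∷ 1298278745189351424 ∷ 1353351311640023040 ∷ 1343151803457146880 ∷ 1246014241978429440 ∷
    1196509153444190208 ∷ 1185861946953347072 ∷ 1205298031604817920 ∷ 1246042816497520640 ∷ 1299321710730373120 ∷
    1356360123402293248 ∷ 1408383463612198912 ∷ 1446617140459008000 ∷ 1462286563041638400 ∷ 1446617140459008000 ∷
    1408383463612198912 ∷ 1356360123402293248 ∷ 1299321710730373120 ∷ 1246042816497520640 ∷ 1205298031604817920 ∷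
    1185861946953347072 ∷ 1196509153444190208 ∷ 1246014241978429440 ∷ 1343151803457146880 ∷ 1353351311640023040 ∷
    1298278745189351424 ∷ 1199600082767425536 ∷ 1078981303036538880 ∷ 958088384658984960 ∷ 858587306297057280 ∷
    802144046613049344 ∷ 810424584269254656 ∷ 905094897927966720 ∷ 996894536240087040 ∷ 996563047856517120 ∷
    928466530448240640 ∷ 816971081686241280 ∷ 686442799241502720 ∷ 561247780785008640 ∷ 465752123987742720 ∷
    424321926520688640 ∷ 461323286054830080 ∷ 529188340396830720 ∷ 580349227353354240 ∷ 567238084731064320 ∷
    508569203931672576 ∷ 423056876356890624 ∷ 329415393408430080 ∷ 246359046488002560 ∷ 192602126997319680 ∷
    186858926338093056 ∷ 209120276430434304 ∷ 239377009194455040 ∷ 257619956550266880 ∷ 243839950417981440 ∷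
    208619585915424768 ∷ 162541458160422912 ∷ 116188162270801920 ∷ 80142293364387840 ∷ 64986446559006720 ∷
    64256045081284608 ∷ 71486512157847552 ∷ 80213271015321600 ∷ 83971744880332800 ∷ 76297356979507200 ∷
    61651160252940288 ∷ 44494207640727552 ∷ 29287552082964480 ∷ 20492246519746560 ∷ 16571632531169280 ∷
    15989051697328128 ∷ 17207845598318592 ∷ 18691355814236160 ∷ 18902923925176320 ∷ 16305891511234560 ∷
    12277101409431552 ∷ 8193396456787968 ∷ 5431619490324480 ∷ 3741682147061760 ∷ 2873496064020480 ∷
    2576972878221312 ∷ 2602024226684928 ∷ 2698561746432000 ∷ 2616497074483200 ∷ 2105741847859200 ∷
    1462489189254144 ∷ 982932221362176 ∷ 642752066877440 ∷ 417629848494080 ∷ 283246688906240 ∷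
    215283710808064 ∷ 189422036893696 ∷ 181342789857280 ∷ 166727092392960 ∷ 121256067194880 ∷
    84879247036416 ∷ 56586164690944 ∷ 35366352931840 ∷ 20209344532480 ∷ 10104672266240 ∷
    4041868906496 ∷ 1010467226624 ∷ []

  collect : ∀ X Y → sameWeight (⅓ * ⅓) * (X + 1ℚ) + crossWeight (⅓ * ⅓) * (Y + Y)
                    ≡ (½ * ⅓ * ⅓) * (ι 5 * 1ℚ + ι 8 * Y + ι 5 * X)
  collect = solve-∀ ℚ-ring
  lhs : sameWeight (⅓ * ⅓) * (x ^ℚ 18 + 1ℚ) + crossWeight (⅓ * ⅓) * (x ^ℚ 9 + x ^ℚ 9)
        ≡ (½ * ⅓ * ⅓) * eval P x
  lhs = trans (collect (x ^ℚ 18) (x ^ℚ 9))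
              (cong ((½ * ⅓ * ⅓) *_) (sym (eval-trinomial 5 8 5 0 9 18 x)))

  collect′ : ∀ X → ½ * (X + 1ℚ) ≡ ½ * (ι 1 * 1ℚ + ι 1 * X)
  collect′ = solve-∀ ℚ-ring
  rhs : ½ * (x ^ℚ 10 + 1ℚ) ≡ ½ * eval Q x
  rhs = trans (collect′ (x ^ℚ 10)) (cong (½ *_) (sym (eval-binomial 1 1 0 10 x)))

-- Approximate roots

archimedean : ∀ q → ∃ λ n → q ≤ ι n
archimedean (mkℚ (ℤ.+ zero) _ _) = 0 , *≤* ℤ.≤-refl
archimedean (mkℚ ℤ.+[1+ k ] _ _) = suc k , *≤* (ℤ.*-monoˡ-≤-nonNeg ℤ.+[1+ k ] (ℤ.+≤+ (ℕ.s≤s ℕ.z≤n)))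
archimedean (mkℚ ℤ.-[1+ k ] _ _) = 0 , *≤* ℤ.-≤+

first-crossing : (P : ℕ → Set) → (∀ m → Dec (P m)) → ¬ P 0 → ∀ j → P j →
                 ∃ λ m → ¬ P m × P (suc m)
first-crossing P P? ¬P0 zero    Pj = ⊥-elim (¬P0 Pj)
first-crossing P P? ¬P0 (suc j) Pj with P? j
... | yes Pj′ = first-crossing P P? ¬P0 j Pj′
... | no ¬Pj′ = j , ¬Pj′ , Pj

quotient : ∀ e {d} → 0ℚ < d → Σ ℚ λ h → h * d ≡ e
quotient e {d} 0<d = e * (1/ d) {{≢-nonZero}} ,
  trans (*-assoc e _ d) (trans (cong (e *_) (*-inverseˡ d {{≢-nonZero}})) (*-identityʳ e))
  where
  ≢-nonZero = pos⇒nonZero d {{positive 0<d}}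

small-multiplier : ∀ {E η} → 0ℚ ≤ E → 0ℚ < η → Σ ℚ λ ε → 0ℚ < ε × ε ≤ 1ℚ × ε * E < η
small-multiplier {E} {η} 0≤E 0<η = ε , 0<ε , ε≤1 , εE<η
  where
  D = E + η + 1ℚ
  η≤D : η ≤ D
  η≤D = ≤-trans (q≤p+q η 0≤E) (p≤p+q (E + η) 0≤1)
  0<D = <-≤-trans 0<η η≤D
  ε = proj₁ (quotient η 0<D)
  εD≡η : ε * D ≡ η
  εD≡η = proj₂ (quotient η 0<D)
  0<ε : 0ℚ < ε
  0<ε = *-cancelʳ-< 0<D (subst₂ _<_ (sym (*-zeroˡ D)) (sym εD≡η) 0<η)
  ε≤1 : ε ≤ 1ℚ
  ε≤1 = *-cancelʳ-≤ 0<D (subst₂ _≤_ (sym εD≡η) (sym (*-identityˡ D)) η≤D)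
  split : ∀ ε E η → ε * (E + η + 1ℚ) ≡ ε * E + ε * (η + 1ℚ)
  split = solve-∀ ℚ-ring
  εE<η : ε * E < η
  εE<η = subst (ε * E <_) (trans (sym (split ε E η)) εD≡η)
           (p<p+q (ε * E) (*-pos 0<ε (<-≤-trans 0<1 (q≤p+q 1ℚ (<⇒≤ 0<η)))))

^-increment-≤ : ∀ {x h} k → 0ℚ ≤ x → 0ℚ ≤ h →
  (x + h) ^ℚ suc k ≤ x ^ℚ suc k + h * (ι (suc k) * (x + h) ^ℚ k)
^-increment-≤ {x} {h} zero 0≤x 0≤h = ≤-reflexive (first-order x h)
  where
  first-order : ∀ x h → (x + h) * 1ℚ ≡ x * 1ℚ + h * (ι 1 * 1ℚ)
  first-order = solve-∀ ℚ-ring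
^-increment-≤ {x} {h} (suc k) 0≤x 0≤h = begin
  (x + h) * (x + h) ^ℚ suc k
    ≤⟨ *-monoˡ-≤ 0≤x+h (^-increment-≤ k 0≤x 0≤h) ⟩
  (x + h) * (X + h * (I * Y))
    ≡⟨ expand x h X Y I ⟩
  x * X + h * X + h * (I * ((x + h) * Y))
    ≤⟨ +-monoˡ-≤ _ (+-monoʳ-≤ (x * X) (*-monoˡ-≤ 0≤h (^-monoˡ-≤ (suc k) 0≤x (p≤p+q x 0≤h)))) ⟩
  x * X + h * ((x + h) * Y) + h * (I * ((x + h) * Y))
    ≡⟨ collect x h X Y I ⟩
  x * X + h * ((1ℚ + I) * ((x + h) * Y))
    ≡⟨ cong (λ c → x * X + h * (c * ((x + h) * Y))) (sym (ι-+ 1 (suc k))) ⟩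
  x * X + h * (ι (suc (suc k)) * (x + h) ^ℚ suc k) ∎
  where
  open ≤-Reasoning
  X = x ^ℚ suc k
  Y = (x + h) ^ℚ k
  I = ι (suc k)
  0≤x+h = +-nonNeg 0≤x 0≤h
  expand : ∀ x h X Y I → (x + h) * (X + h * (I * Y)) ≡ x * X + h * X + h * (I * ((x + h) * Y))
  expand = solve-∀ ℚ-ring
  collect : ∀ x h X Y I → x * X + h * ((x + h) * Y) + h * (I * ((x + h) * Y))
                          ≡ x * X + h * ((1ℚ + I) * ((x + h) * Y))
  collect = solve-∀ ℚ-ring

root-≤-+1 : ∀ {x a} k → 0ℚ ≤ a → x ^ℚ suc k ≤ a → x ≤ a + 1ℚ
root-≤-+1 {x} {a} k 0≤a xᵏ≤a with ≤-total x 1ℚ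
... | inj₁ x≤1 = ≤-trans x≤1 (q≤p+q 1ℚ 0≤a)
... | inj₂ 1≤x = ≤-trans (≤-trans (≤-^ k 1≤x) xᵏ≤a) (p≤p+q a 0≤1)

-- A grid of mesh h crosses the level a between jh and (j+1)h; h is chosen so fine that the K-th
-- power moves by less than ε across one step.
^-approximate-root : ∀ K′ {a ε} → 0ℚ ≤ a → 0ℚ < ε →
  Σ ℚ λ w → 0ℚ ≤ w × a < w ^ℚ suc K′ × w ^ℚ suc K′ ≤ a + ε
^-approximate-root K′ {a} {ε} 0≤a 0<ε = w , 0≤w , a<wᴷ , wᴷ≤a+ε
  where
  K = suc K′
  0≤a+1 = +-nonNeg 0≤a 0≤1
  E = ι K * (a + 1ℚ + 1ℚ) ^ℚ K′
  step = small-multiplier {E} (*-nonNeg (ι-nonNeg K) (^-nonNeg K′ (+-nonNeg 0≤a+1 0≤1))) 0<ε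
  h = proj₁ step
  0<h = proj₁ (proj₂ step)
  0≤h = <⇒≤ 0<h
  h≤1 = proj₁ (proj₂ (proj₂ step))
  hE<ε = proj₂ (proj₂ (proj₂ step))

  grid : ℕ → ℚ
  grid j = ι j * h
  0≤grid : ∀ j → 0ℚ ≤ grid j
  0≤grid j = *-nonNeg (ι-nonNeg j) 0≤h

  Above : ℕ → Set
  Above j = a < grid j ^ℚ K
  ¬Above0 : ¬ Above 0
  ¬Above0 a<0 = <⇒≱ a<0 (subst (_≤ a) (sym (trans (cong (_^ℚ K) (*-zeroˡ h)) (^-zeroˡ K′))) 0≤a)

  far = quotient (a + 1ℚ) 0<h
  j₀ = proj₁ (archimedean (proj₁ far))
  a+1≤gridj₀ : a + 1ℚ ≤ grid j₀
  a+1≤gridj₀ = subst (_≤ grid j₀) (proj₂ far) (*-monoʳ-≤ 0≤h (proj₂ (archimedean (proj₁ far))))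
  Abovej₀ : Above j₀
  Abovej₀ = <-≤-trans (p<p+q a 0<1)
    (≤-trans a+1≤gridj₀ (≤-^ K′ (≤-trans (q≤p+q 1ℚ 0≤a) a+1≤gridj₀)))

  crossing = first-crossing Above (λ j → a <? grid j ^ℚ K) ¬Above0 j₀ Abovej₀
  m = proj₁ crossing
  gridmᴷ≤a : grid m ^ℚ K ≤ a
  gridmᴷ≤a = ≮⇒≥ (proj₁ (proj₂ crossing))

  w = grid (suc m)
  0≤w = 0≤grid (suc m)
  a<wᴷ = proj₂ (proj₂ crossing)
  w≡gridm+h : w ≡ grid m + h
  w≡gridm+h = trans (cong (_* h) (ι-+ 1 m)) (distrib (ι m) h)
    where
    distrib : ∀ i h → (ι 1 + i) * h ≡ i * h + h
    distrib = solve-∀ ℚ-ring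
  w≤a+1+1 : w ≤ a + 1ℚ + 1ℚ
  w≤a+1+1 = subst (_≤ a + 1ℚ + 1ℚ) (sym w≡gridm+h) (+-mono-≤ (root-≤-+1 {grid m} K′ 0≤a gridmᴷ≤a) h≤1)

  wᴷ≤a+ε : w ^ℚ K ≤ a + ε
  wᴷ≤a+ε = begin
    w ^ℚ K                                      ≡⟨ cong (_^ℚ K) w≡gridm+h ⟩
    (grid m + h) ^ℚ K                           ≤⟨ ^-increment-≤ {grid m} {h} K′ (0≤grid m) 0≤h ⟩
    grid m ^ℚ K + h * (ι K * (grid m + h) ^ℚ K′) ≡⟨ cong (λ y → grid m ^ℚ K + h * (ι K * y ^ℚ K′))
                                                         (sym w≡gridm+h) ⟩
    grid m ^ℚ K + h * (ι K * w ^ℚ K′)            ≤⟨ +-mono-≤ gridmᴷ≤a (*-monoˡ-≤ 0≤h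
                                                      (*-monoˡ-≤ (ι-nonNeg K) (^-monoˡ-≤ K′ 0≤w w≤a+1+1))) ⟩
    a + h * E                                   ≤⟨ +-monoʳ-≤ a (<⇒≤ hE<ε) ⟩
    a + ε                                       ∎
    where open ≤-Reasoning

^-rightContinuous : ∀ {b p} r′ → 0ℚ ≤ p → (∀ ε → 0ℚ < ε → b ≤ (p + ε) ^ℚ suc r′) →
                    b ≤ p ^ℚ suc r′
^-rightContinuous {b} {p} r′ 0≤p b≤[p+ε]ʳ with b ≤? p ^ℚ suc r′
... | yes b≤pʳ = b≤pʳ
... | no  b≰pʳ = ⊥-elim (<-irrefl refl b<b)
  where
  r = suc r′
  Δ = b - p ^ℚ r
  E = ι r * (p + 1ℚ) ^ℚ r′
  step = small-multiplier {E} (*-nonNeg (ι-nonNeg r) (^-nonNeg r′ (+-nonNeg 0≤p 0≤1)))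
                              (p<q⇒0<q-p (≰⇒> b≰pʳ))
  ε = proj₁ step
  0≤ε = <⇒≤ (proj₁ (proj₂ step))
  ε≤1 = proj₁ (proj₂ (proj₂ step))
  εE<Δ = proj₂ (proj₂ (proj₂ step))
  cancel : ∀ P b → P + (b - P) ≡ b
  cancel = solve-∀ ℚ-ring
  b<b : b < b
  b<b = begin-strict
    b                              ≤⟨ b≤[p+ε]ʳ ε (proj₁ (proj₂ step)) ⟩
    (p + ε) ^ℚ r                   ≤⟨ ^-increment-≤ r′ 0≤p 0≤ε ⟩
    p ^ℚ r + ε * (ι r * (p + ε) ^ℚ r′)
      ≤⟨ +-monoʳ-≤ (p ^ℚ r) (*-monoˡ-≤ 0≤ε (*-monoˡ-≤ (ι-nonNeg r)
            (^-monoˡ-≤ r′ (+-nonNeg 0≤p 0≤ε) (+-monoʳ-≤ p ε≤1)))) ⟩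
    p ^ℚ r + ε * E                 <⟨ +-monoʳ-< (p ^ℚ r) εE<Δ ⟩
    p ^ℚ r + Δ                     ≡⟨ cancel (p ^ℚ r) b ⟩
    b                              ∎
    where open ≤-Reasoning

-- The hypothesis says s ≤ p^(M/K); raising to the power q gives s^q ≤ p^(Mq/K) = p^r.
≤-via-approximate-roots : ∀ {s p} K′ M q′ r′ → M ℕ.* suc q′ ≡ suc K′ ℕ.* suc r′ →
  0ℚ ≤ s → 0ℚ ≤ p → (∀ u → 0ℚ ≤ u → p < u ^ℚ suc K′ → s ≤ u ^ℚ M) →
  s ^ℚ suc q′ ≤ p ^ℚ suc r′
≤-via-approximate-roots {s} {p} K′ M q′ r′ Mq≡Kr 0≤s 0≤p s≤uᴹ =
  ^-rightContinuous r′ 0≤p λ ε 0<ε →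
    let (w , 0≤w , p<wᴷ , wᴷ≤p+ε) = ^-approximate-root K′ 0≤p 0<ε
    in begin
      s ^ℚ suc q′                ≤⟨ ^-monoˡ-≤ (suc q′) 0≤s (s≤uᴹ w 0≤w p<wᴷ) ⟩
      (w ^ℚ M) ^ℚ suc q′         ≡⟨ ^-*-assoc w M (suc q′) ⟩
      w ^ℚ (M ℕ.* suc q′)        ≡⟨ cong (w ^ℚ_) Mq≡Kr ⟩
      w ^ℚ (suc K′ ℕ.* suc r′)   ≡⟨ sym (^-*-assoc w (suc K′) (suc r′)) ⟩
      (w ^ℚ suc K′) ^ℚ suc r′    ≤⟨ ^-monoˡ-≤ (suc r′) (^-nonNeg (suc K′) 0≤w) wᴷ≤p+ε ⟩
      (p + ε) ^ℚ suc r′          ∎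
  where open ≤-Reasoning

-- Hypercontractive bound for Boolean functions

bit-nonNeg : ∀ b → 0ℚ ≤ bit b
bit-nonNeg true  = 0≤1
bit-nonNeg false = ≤-refl

bit²≡bit : ∀ b → bit b * bit b ≡ bit b
bit²≡bit true  = refl
bit²≡bit false = refl

mean : ∀ {n} → (Cube n → Bool) → ℚ
mean {n} f = 𝔼 n (toℚ f)

mean-nonNeg : ∀ {n} (f : Cube n → Bool) → 0ℚ ≤ mean f
mean-nonNeg f = 𝔼-nonNeg (λ x → bit-nonNeg (f x))

noiseForm-self-Boolean : ∀ {n} (f : Cube n → Bool) → noiseForm 1ℚ (toℚ f) (toℚ f) ≡ mean f
noiseForm-self-Boolean f = trans (parseval (toℚ f) (toℚ f)) (𝔼-cong (λ x → bit²≡bit (f x)))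

module Hypercontractivity (ρ : ℚ) (K′ m : ℕ) (0≤ρ : 0ℚ ≤ ρ) (ρ≤1 : ρ ≤ 1ℚ)
                          (twoPoint : TwoPoint ρ (suc K′) m) where

  K M : ℕ
  K = suc K′
  M = m ℕ.+ m

  twoPoint-homogeneous : ∀ {w₀ w₁} → 0ℚ ≤ w₀ → 0ℚ < w₁ →
    (sameWeight ρ * (w₀ ^ℚ M + w₁ ^ℚ M)
      + crossWeight ρ * (w₀ ^ℚ m * w₁ ^ℚ m + w₀ ^ℚ m * w₁ ^ℚ m)) ^ℚ K
    ≤ (½ * (w₀ ^ℚ K + w₁ ^ℚ K)) ^ℚ M
  twoPoint-homogeneous {w₀} {w₁} 0≤w₀ 0<w₁ = subst (λ z → L z ≤ R z) xw₁≡w₀ (begin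
    L (x * w₁)                 ≡⟨ cong (_^ℚ K) lhs-base ⟩
    (w₁ ^ℚ M * φ) ^ℚ K         ≡⟨ ^-distribʳ-* (w₁ ^ℚ M) φ K ⟩
    (w₁ ^ℚ M) ^ℚ K * φ ^ℚ K    ≡⟨ cong (_* φ ^ℚ K) (^-swap w₁ M K) ⟩
    (w₁ ^ℚ K) ^ℚ M * φ ^ℚ K    ≤⟨ *-monoˡ-≤ (^-nonNeg M (^-nonNeg K (<⇒≤ 0<w₁))) (twoPoint x 0≤x) ⟩
    (w₁ ^ℚ K) ^ℚ M * ψ ^ℚ M    ≡⟨ sym (^-distribʳ-* (w₁ ^ℚ K) ψ M) ⟩
    (w₁ ^ℚ K * ψ) ^ℚ M         ≡⟨ cong (_^ℚ M) (sym rhs-base) ⟩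
    R (x * w₁)                 ∎)
    where
    open ≤-Reasoning
    x = proj₁ (quotient w₀ 0<w₁)
    xw₁≡w₀ : x * w₁ ≡ w₀
    xw₁≡w₀ = proj₂ (quotient w₀ 0<w₁)
    0≤x : 0ℚ ≤ x
    0≤x = *-cancelʳ-≤ 0<w₁ (subst₂ _≤_ (sym (*-zeroˡ w₁)) (sym xw₁≡w₀) 0≤w₀)

    L R : ℚ → ℚ
    L z = (sameWeight ρ * (z ^ℚ M + w₁ ^ℚ M)
            + crossWeight ρ * (z ^ℚ m * w₁ ^ℚ m + z ^ℚ m * w₁ ^ℚ m)) ^ℚ K
    R z = (½ * (z ^ℚ K + w₁ ^ℚ K)) ^ℚ M
    φ = sameWeight ρ * (x ^ℚ M + 1ℚ) + crossWeight ρ * (x ^ℚ m + x ^ℚ m)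
    ψ = ½ * (x ^ℚ K + 1ℚ)
    b = w₁ ^ℚ m
    w₁ᴹ≡b² : w₁ ^ℚ M ≡ b * b
    w₁ᴹ≡b² = ^-distribˡ-+-* w₁ m m

    factor-lhs : ∀ s c X Y b → s * (X * (b * b) + b * b) + c * (Y * b * b + Y * b * b)
                               ≡ (b * b) * (s * (X + 1ℚ) + c * (Y + Y))
    factor-lhs = solve-∀ ℚ-ring
    factor-rhs : ∀ X B → ½ * (X * B + B) ≡ B * (½ * (X + 1ℚ))
    factor-rhs = solve-∀ ℚ-ring

    lhs-base : sameWeight ρ * ((x * w₁) ^ℚ M + w₁ ^ℚ M)
                 + crossWeight ρ * ((x * w₁) ^ℚ m * b + (x * w₁) ^ℚ m * b)
               ≡ w₁ ^ℚ M * φ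
    lhs-base = begin-equality
      sameWeight ρ * ((x * w₁) ^ℚ M + w₁ ^ℚ M)
        + crossWeight ρ * ((x * w₁) ^ℚ m * b + (x * w₁) ^ℚ m * b)
        ≡⟨ cong₂ (λ u v → sameWeight ρ * (u + w₁ ^ℚ M) + crossWeight ρ * (v * b + v * b))
                 (trans (^-distribʳ-* x w₁ M) (cong (x ^ℚ M *_) w₁ᴹ≡b²)) (^-distribʳ-* x w₁ m) ⟩
      sameWeight ρ * (x ^ℚ M * (b * b) + w₁ ^ℚ M)
        + crossWeight ρ * (x ^ℚ m * b * b + x ^ℚ m * b * b)
        ≡⟨ cong (λ B → sameWeight ρ * (x ^ℚ M * (b * b) + B)
                         + crossWeight ρ * (x ^ℚ m * b * b + x ^ℚ m * b * b)) w₁ᴹ≡b² ⟩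
      sameWeight ρ * (x ^ℚ M * (b * b) + b * b)
        + crossWeight ρ * (x ^ℚ m * b * b + x ^ℚ m * b * b)
        ≡⟨ factor-lhs (sameWeight ρ) (crossWeight ρ) (x ^ℚ M) (x ^ℚ m) b ⟩
      (b * b) * φ
        ≡⟨ cong (_* φ) (sym w₁ᴹ≡b²) ⟩
      w₁ ^ℚ M * φ ∎

    rhs-base : ½ * ((x * w₁) ^ℚ K + w₁ ^ℚ K) ≡ w₁ ^ℚ K * ψ
    rhs-base = trans (cong (λ u → ½ * (u + w₁ ^ℚ K)) (^-distribʳ-* x w₁ K))
                     (factor-rhs (x ^ℚ K) (w₁ ^ℚ K))

  S : ∀ {n} → (Cube n → Bool) → ℚ
  S f = noiseForm ρ (toℚ f) (toℚ f)

  S-nonNeg : ∀ {n} (f : Cube n → Bool) → 0ℚ ≤ S f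
  S-nonNeg f = noiseForm-self-nonNeg (toℚ f) 0≤ρ

  S-suc : ∀ {n} (f : Cube (suc n) → Bool) →
    S f ≡ sameWeight ρ * (S (slice₀ f) + S (slice₁ f))
          + crossWeight ρ * (noiseForm ρ (toℚ (slice₀ f)) (toℚ (slice₁ f))
                             + noiseForm ρ (toℚ (slice₀ f)) (toℚ (slice₁ f)))
  S-suc f = trans (noiseForm-suc ρ (toℚ f) (toℚ f))
    (cong (λ c → sameWeight ρ * (S (slice₀ f) + S (slice₁ f))
                 + crossWeight ρ * (noiseForm ρ (toℚ (slice₀ f)) (toℚ (slice₁ f)) + c))
          (noiseForm-comm ρ (toℚ (slice₁ f)) (toℚ (slice₀ f))))

  bit-≤ : ∀ b {u} → 0ℚ ≤ u → bit b < u ^ℚ K → bit b ≤ u ^ℚ M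
  bit-≤ false 0≤u _ = ^-nonNeg M 0≤u
  bit-≤ true {u} 0≤u 1<uᴷ with u ≤? 1ℚ
  ... | yes u≤1 = ⊥-elim (<⇒≱ 1<uᴷ (^-≤1 K 0≤u u≤1))
  ... | no  u≰1 = 1≤^ M (<⇒≤ (≰⇒> u≰1))

  -- The statement S(f) ≤ E[f]^(M/K), phrased without roots.
  S-≤ : ∀ n (f : Cube n → Bool) {u} → 0ℚ ≤ u → mean f < u ^ℚ K → S f ≤ u ^ℚ M
  S-≤ zero f 0≤u p<uᴷ =
    subst (_≤ _) (sym (trans (noiseForm-zero ρ (toℚ f) (toℚ f)) (bit²≡bit (f []))))
      (bit-≤ (f []) 0≤u (subst (_< _) (𝔼-zero (toℚ f)) p<uᴷ))
  S-≤ (suc n) f {u} 0≤u p<uᴷ = begin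
    S f
      ≡⟨ S-suc f ⟩
    sameWeight ρ * (S f₀ + S f₁) + crossWeight ρ * (B + B)
      ≤⟨ +-mono-≤ (*-monoˡ-≤ (*-nonNeg (nonNegative⁻¹ (½ * ½)) (+-nonNeg 0≤1 0≤ρ))
                             (+-mono-≤ Sf₀≤ Sf₁≤))
                  (*-monoˡ-≤ (*-nonNeg (nonNegative⁻¹ (½ * ½)) (p≤q⇒0≤q-p ρ≤1))
                             (+-mono-≤ B≤ B≤)) ⟩
    sameWeight ρ * (w₀ ^ℚ M + w₁ ^ℚ M) + crossWeight ρ * (w₀ ^ℚ m * w₁ ^ℚ m + w₀ ^ℚ m * w₁ ^ℚ m)
      ≤⟨ ^-cancelˡ-≤ K′ (^-nonNeg M 0≤u) (begin
           _ ≤⟨ twoPoint-homogeneous 0≤w₀ 0<w₁ ⟩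
           (½ * (w₀ ^ℚ K + w₁ ^ℚ K)) ^ℚ M
             ≤⟨ ^-monoˡ-≤ M (*-nonNeg (nonNegative⁻¹ ½) (+-nonNeg (^-nonNeg K 0≤w₀) (^-nonNeg K 0≤w₁)))
                  average≤uᴷ ⟩
           (u ^ℚ K) ^ℚ M ≡⟨ ^-swap u K M ⟩
           (u ^ℚ M) ^ℚ K ∎) ⟩
    u ^ℚ M ∎
    where
    open ≤-Reasoning
    f₀ = slice₀ f
    f₁ = slice₁ f
    B = noiseForm ρ (toℚ f₀) (toℚ f₁)
    0<ε = p<q⇒0<q-p p<uᴷ
    root₀ = ^-approximate-root K′ (mean-nonNeg f₀) 0<ε
    root₁ = ^-approximate-root K′ (mean-nonNeg f₁) 0<ε
    w₀ = proj₁ root₀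
    w₁ = proj₁ root₁
    0≤w₀ = proj₁ (proj₂ root₀)
    0≤w₁ = proj₁ (proj₂ root₁)
    0<w₁ : 0ℚ < w₁
    0<w₁ = ≰⇒> λ w₁≤0 → <⇒≱ (proj₁ (proj₂ (proj₂ root₁)))
      (subst (_≤ mean f₁) (sym (trans (cong (_^ℚ K) (≤-antisym w₁≤0 0≤w₁)) (^-zeroˡ K′)))
             (mean-nonNeg f₁))
    Sf₀≤ : S f₀ ≤ w₀ ^ℚ M
    Sf₀≤ = S-≤ n f₀ 0≤w₀ (proj₁ (proj₂ (proj₂ root₀)))
    Sf₁≤ : S f₁ ≤ w₁ ^ℚ M
    Sf₁≤ = S-≤ n f₁ 0≤w₁ (proj₁ (proj₂ (proj₂ root₁)))

    B≤ : B ≤ w₀ ^ℚ m * w₁ ^ℚ m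
    B≤ = ^-cancelˡ-≤ 1 (*-nonNeg (^-nonNeg m 0≤w₀) (^-nonNeg m 0≤w₁)) (begin
      B ^ℚ 2                           ≤⟨ noiseForm-cauchy-schwarz (toℚ f₀) (toℚ f₁) 0≤ρ ⟩
      S f₀ * S f₁                      ≤⟨ *-mono-≤ (S-nonNeg f₀) Sf₀≤ (S-nonNeg f₁) Sf₁≤ ⟩
      w₀ ^ℚ M * w₁ ^ℚ M                ≡⟨ cong₂ _*_ (^-distribˡ-+-* w₀ m m) (^-distribˡ-+-* w₁ m m) ⟩
      w₀ ^ℚ m * w₀ ^ℚ m * (w₁ ^ℚ m * w₁ ^ℚ m)
                                       ≡⟨ regroup (w₀ ^ℚ m) (w₁ ^ℚ m) ⟩
      (w₀ ^ℚ m * w₁ ^ℚ m) ^ℚ 2         ∎)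
      where
      regroup : ∀ a b → a * a * (b * b) ≡ (a * b) * ((a * b) * 1ℚ)
      regroup = solve-∀ ℚ-ring

    average≤uᴷ : ½ * (w₀ ^ℚ K + w₁ ^ℚ K) ≤ u ^ℚ K
    average≤uᴷ = begin
      ½ * (w₀ ^ℚ K + w₁ ^ℚ K)
        ≤⟨ *-monoˡ-≤ (nonNegative⁻¹ ½) (+-mono-≤ (proj₂ (proj₂ (proj₂ root₀)))
                                                 (proj₂ (proj₂ (proj₂ root₁)))) ⟩
      ½ * (mean f₀ + ε + (mean f₁ + ε))
        ≡⟨ shift (mean f₀) (mean f₁) ε ⟩
      ½ * (mean f₀ + mean f₁) + ε
        ≡⟨ cong (_+ ε) (sym (𝔼-suc (toℚ f))) ⟩
      mean f + (u ^ℚ K - mean f)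
        ≡⟨ cancel (mean f) (u ^ℚ K) ⟩
      u ^ℚ K ∎
      where
      ε = u ^ℚ K - mean f
      shift : ∀ a b ε → ½ * (a + ε + (b + ε)) ≡ ½ * (a + b) + ε
      shift = solve-∀ ℚ-ring
      cancel : ∀ p U → p + (U - p) ≡ U
      cancel = solve-∀ ℚ-ring

  S-bound : ∀ {n} (f : Cube n → Bool) q′ r′ → M ℕ.* suc q′ ≡ K ℕ.* suc r′ →
            S f ^ℚ suc q′ ≤ mean f ^ℚ suc r′
  S-bound {n} f q′ r′ Mq≡Kr = ≤-via-approximate-roots K′ M q′ r′ Mq≡Kr (S-nonNeg f) (mean-nonNeg f)
    (λ u 0≤u p<uᴷ → S-≤ n f 0≤u p<uᴷ)

proposition2p8 : (n : ℕ) (f g : Cube n → Bool) →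
    let p₁ = 𝔼 n (toℚ f)
        p₂ = 𝔼 n (toℚ g)
        L = noiseCorr n f g
    in ((L ^ℚ 10) ≤ (p₁ ^ℚ 9) * (p₂ ^ℚ 5)) × ((L ^ℚ 4) ≤ (p₁ ^ℚ 3) * (p₂ ^ℚ 3))
proposition2p8 n f g = L¹⁰≤ , L⁴≤
  where
  module H₃ = Hypercontractivity ⅓ 3 3 (nonNegative⁻¹ ⅓) (toWitness {a? = ⅓ ≤? 1ℚ} _) twoPoint-⅓
  module H₉ = Hypercontractivity (⅓ * ⅓) 9 9 (nonNegative⁻¹ (⅓ * ⅓))
                                 (toWitness {a? = ⅓ * ⅓ ≤? 1ℚ} _) twoPoint-⅑
  open ≤-Reasoning
  L = noiseCorr n f g

  L⁴≤ : L ^ℚ 4 ≤ mean f ^ℚ 3 * mean g ^ℚ 3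
  L⁴≤ = begin
    L ^ℚ 4                      ≡⟨ sym (^-*-assoc L 2 2) ⟩
    (L ^ℚ 2) ^ℚ 2               ≤⟨ ^-monoˡ-≤ 2 (^2-nonNeg L)
                                     (noiseForm-cauchy-schwarz (toℚ f) (toℚ g) (nonNegative⁻¹ ⅓)) ⟩
    (H₃.S f * H₃.S g) ^ℚ 2      ≡⟨ ^-distribʳ-* (H₃.S f) (H₃.S g) 2 ⟩
    H₃.S f ^ℚ 2 * H₃.S g ^ℚ 2   ≤⟨ *-mono-≤ (^-nonNeg 2 (H₃.S-nonNeg f)) (H₃.S-bound f 1 2 refl)
                                            (^-nonNeg 2 (H₃.S-nonNeg g)) (H₃.S-bound g 1 2 refl) ⟩
    mean f ^ℚ 3 * mean g ^ℚ 3   ∎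

  L¹⁰≤ : L ^ℚ 10 ≤ mean f ^ℚ 9 * mean g ^ℚ 5
  L¹⁰≤ = begin
    L ^ℚ 10                     ≡⟨ sym (^-*-assoc L 2 5) ⟩
    (L ^ℚ 2) ^ℚ 5               ≤⟨ ^-monoˡ-≤ 5 (^2-nonNeg L)
                                     (subst (λ p → L ^ℚ 2 ≤ H₉.S f * p) (noiseForm-self-Boolean g)
                                            (noiseForm-cauchy-schwarz′ ⅓ (toℚ f) (toℚ g))) ⟩
    (H₉.S f * mean g) ^ℚ 5      ≡⟨ ^-distribʳ-* (H₉.S f) (mean g) 5 ⟩
    H₉.S f ^ℚ 5 * mean g ^ℚ 5   ≤⟨ *-monoʳ-≤ (^-nonNeg 5 (mean-nonNeg g)) (H₉.S-bound f 4 8 refl) ⟩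
    mean f ^ℚ 9 * mean g ^ℚ 5   ∎
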